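{- Fix $\ell\ge 1$ and $\ell$-tuples of non-negative integers $\vec\alpha,\vec\beta$. For every $m\ge1$, $$M^\ell_m(\vec\alpha,\vec\beta,t)=t\,M^\ell_0(\vec\alpha,\vec\beta,t)\,M^\ell_{m-1}(\vec\beta,\vec\beta,t)=t^m\,M^\ell_0(\vec\alpha,\vec\beta,t)\,M^\ell_0(\vec\beta,\vec\beta,t)^m.$$
   Context: An order-$\ell$ Motzkin path of length $n$ and height $m$ is an integer lattice path from $(0,0)$ to $(n,m)$ using steps $U=(1,1)$ and $D_i=(1,-i)$ for $0\le i\le \ell$, never going below $y=0$. For $\ell$-tuples of non-negative integers $\vec\alpha=(\alpha_0,\dots,\alpha_{\ell-1}),\vec\beta=(\beta_0,\dots,\beta_{\ell-1})$, an $(\vec\alpha,\vec\beta)$-colored Motzkin path is such a path in which, for each $0\le i\le \ell-1$, each $D_i$ step whose right endpoint is at height $0$ is labeled by one of $\alpha_i$ colors and each $D_i$ step whose right endpoint is at height $>0$ is labeled by one of $\beta_i$ colors; $U$ and $D_\ell$ steps are unlabeled. $M^\ell_{n,m}(\vec\alpha,\vec\beta)$ is the number of such colored paths of length $n$ and height $m$, and $M^\ell_m(\vec\alpha,\vec\beta,t)=\sum_{n\ge0}M^\ell_{n,m}(\vec\alpha,\vec\beta)t^n$. -}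

module Defs where

open import Data.Nat using (ℕ; zero; suc; _+_; _*_; _∸_; _≤?_; _≟_)
open import Data.Fin using (Fin; toℕ; fromℕ<)
open import Data.Vec using (Vec; lookup)
open import Data.List using (List; []; _∷_; map; concatMap; upTo; allFin)
open import Data.Nat.ListAction using (sum)
open import Relation.Binary.PropositionalEquality using (_≡_)
open import Relation.Nullary using (yes; no)

-- Steps of an order-ℓ Motzkin path: U = (1,1), D i = (1,-i) for 0 ≤ i ≤ ℓ.
data Step (ℓ : ℕ) : Set where
  U : Step ℓ
  D : Fin (suc ℓ) → Step ℓ

allSteps : (ℓ : ℕ) → List (Step ℓ)
allSteps ℓ = U ∷ map D (allFin (suc ℓ))

allSeqs : (ℓ n : ℕ) → List (List (Step ℓ))
allSeqs ℓ zero = [] ∷ []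
allSeqs ℓ (suc n) = concatMap (λ s → map (s ∷_) (allSeqs ℓ n)) (allSteps ℓ)

-- number of colours available for a D_i step whose right endpoint is at height h
-- (D_ℓ is unlabelled: 1 choice; D_i with i < ℓ: α_i choices if h = 0, β_i if h > 0)
colours : {ℓ : ℕ} → Vec ℕ ℓ → Vec ℕ ℓ → Fin (suc ℓ) → ℕ → ℕ
colours {ℓ} α β i h with suc (toℕ i) ≤? ℓ
... | no _ = 1
... | yes i<ℓ with h
...   | zero  = lookup α (fromℕ< i<ℓ)
...   | suc _ = lookup β (fromℕ< i<ℓ)

-- number of colourings of the step sequence s started at height h, if it stays
-- at height ≥ 0 and ends at height m; 0 if it is not such a path.
pathCount : {ℓ : ℕ} → Vec ℕ ℓ → Vec ℕ ℓ → ℕ → List (Step ℓ) → ℕ → ℕ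
pathCount α β h [] m with h ≟ m
... | yes _ = 1
... | no _  = 0
pathCount α β h (U ∷ s) m = pathCount α β (suc h) s m
pathCount α β h (D i ∷ s) m with toℕ i ≤? h
... | yes _ = colours α β i (h ∸ toℕ i) * pathCount α β (h ∸ toℕ i) s m
... | no _  = 0

M : (ℓ : ℕ) → Vec ℕ ℓ → Vec ℕ ℓ → (n m : ℕ) → ℕ
M ℓ α β n m = sum (map (λ s → pathCount α β 0 s m) (allSeqs ℓ n))

-- Formal power series over ℕ in t, as coefficient sequences.
Series : Set
Series = ℕ → ℕ

-- M^ℓ_m(α,β,t) = Σ_n M^ℓ_{n,m}(α,β) t^n
Mgf : (ℓ : ℕ) → Vec ℕ ℓ → Vec ℕ ℓ → ℕ → Series
Mgf ℓ α β m n = M ℓ α β n m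

_⋆_ : Series → Series → Series
(f ⋆ g) n = sum (map (λ k → f k * g (n ∸ k)) (upTo (suc n)))

tx : Series → Series
tx f zero = 0
tx f (suc n) = f n

oneS : Series
oneS zero = 1
oneS (suc _) = 0

tpow : ℕ → Series → Series
tpow zero f = f
tpow (suc m) f = tx (tpow m f)

_^S_ : Series → ℕ → Series
f ^S zero = oneS
f ^S suc m = f ⋆ (f ^S m)

_≈S_ : Series → Series → Set
f ≈S g = ∀ n → f n ≡ g n

-- Cut a path ending at height m+1 at its last visit to height 0: before it lies an
-- (α,β)-path from 0 to 0, then comes a U step, and after it a path from 1 to m+1 that never
-- returns to 0.  Shifted down by one, the latter is a (β,β)-path from 0 to m, because all its
-- labelled steps end at positive height.  This is the first identity; iterating it on the
-- (β,β)-paths gives the second.  Formally the cut is carried out for every starting height h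
-- (where a path from h may also avoid 0 altogether) and proved by induction on the length,
-- both sides obeying the first-step recurrence of the path counts.
module Submission where

open import Defs
open import Data.Nat using (ℕ; zero; suc; _+_; _*_; _∸_; _≤_; _≤?_; _≟_; s≤s; z≤n)
open import Data.Vec using (Vec)
open import Data.Product using (_×_; _,_)
open import Data.Nat.Properties
  using (+-identityʳ; +-assoc; *-zeroʳ; *-identityʳ; *-assoc; *-distribˡ-+; *-distribʳ-+;
         +-∸-assoc; 0∸n≡0; m≤n⇒m∸n≡0; ≰⇒>; m≤n⇒m≤1+n; suc-injective; +-commutativeSemigroup)
open import Algebra.Properties.CommutativeSemigroup +-commutativeSemigroup using (interchange)
open import Data.Fin using (Fin; toℕ)
open import Data.List using (List; []; _∷_; _++_; map; concatMap; upTo; allFin; applyUpTo)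
open import Data.List.Properties using (map-cong; map-∘; map-++; map-applyUpTo; map-upTo)
open import Data.Nat.ListAction using (sum)
open import Data.Nat.ListAction.Properties using (sum-++)
open import Function using (_∘_)
open import Relation.Binary.PropositionalEquality
  using (_≡_; refl; sym; trans; cong; cong₂; module ≡-Reasoning)
open import Relation.Nullary using (yes; no)
open import Relation.Nullary.Negation using (contradiction)

private
  variable
    A B : Set
    ℓ : ℕ

sum-map-+ : (f g : A → ℕ) (xs : List A) →
            sum (map (λ x → f x + g x) xs) ≡ sum (map f xs) + sum (map g xs)
sum-map-+ f g [] = refl
sum-map-+ f g (x ∷ xs) =
  trans (cong (f x + g x +_) (sum-map-+ f g xs)) (interchange (f x) (g x) _ _)

sum-map-*ˡ : (c : ℕ) (f : A → ℕ) (xs : List A) →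
             sum (map (λ x → c * f x) xs) ≡ c * sum (map f xs)
sum-map-*ˡ c f [] = sym (*-zeroʳ c)
sum-map-*ˡ c f (x ∷ xs) =
  trans (cong (c * f x +_) (sum-map-*ˡ c f xs)) (sym (*-distribˡ-+ c (f x) _))

sum-map-*ʳ : (c : ℕ) (f : A → ℕ) (xs : List A) →
             sum (map (λ x → f x * c) xs) ≡ sum (map f xs) * c
sum-map-*ʳ c f [] = refl
sum-map-*ʳ c f (x ∷ xs) =
  trans (cong (f x * c +_) (sum-map-*ʳ c f xs)) (sym (*-distribʳ-+ c (f x) _))

sum-map-zero : (xs : List A) → sum (map (λ _ → 0) xs) ≡ 0
sum-map-zero [] = refl
sum-map-zero (_ ∷ xs) = sum-map-zero xs

sum-map-comm : (f : A → B → ℕ) (xs : List A) (ys : List B) →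
               sum (map (λ x → sum (map (f x) ys)) xs) ≡
               sum (map (λ y → sum (map (λ x → f x y) xs)) ys)
sum-map-comm f [] ys = sym (sum-map-zero ys)
sum-map-comm f (x ∷ xs) ys =
  trans (cong (sum (map (f x) ys) +_) (sum-map-comm f xs ys)) (sym (sum-map-+ (f x) _ ys))

sum-concatMap : (P : B → ℕ) (f : A → List B) (xs : List A) →
                sum (map P (concatMap f xs)) ≡ sum (map (λ x → sum (map P (f x))) xs)
sum-concatMap P f [] = refl
sum-concatMap P f (x ∷ xs) = begin
  sum (map P (f x ++ concatMap f xs))
    ≡⟨ cong sum (map-++ P (f x) (concatMap f xs)) ⟩
  sum (map P (f x) ++ map P (concatMap f xs))
    ≡⟨ sum-++ (map P (f x)) (map P (concatMap f xs)) ⟩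
  sum (map P (f x)) + sum (map P (concatMap f xs))
    ≡⟨ cong (sum (map P (f x)) +_) (sum-concatMap P f xs) ⟩
  sum (map P (f x)) + sum (map (λ y → sum (map P (f y))) xs) ∎
  where open ≡-Reasoning

_⊕_ : Series → Series → Series
(f ⊕ g) n = f n + g n

≈S-trans : {f g h : Series} → f ≈S g → g ≈S h → f ≈S h
≈S-trans f≈g g≈h n = trans (f≈g n) (g≈h n)

tx-cong : {f g : Series} → f ≈S g → tx f ≈S tx g
tx-cong f≈g zero = refl
tx-cong f≈g (suc n) = f≈g n

tx-⊕ : (f g : Series) → tx (f ⊕ g) ≈S (tx f ⊕ tx g)
tx-⊕ f g zero = refl
tx-⊕ f g (suc n) = refl

⋆-cong : {f f′ g g′ : Series} → f ≈S f′ → g ≈S g′ → (f ⋆ g) ≈S (f′ ⋆ g′)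
⋆-cong f≈f′ g≈g′ n =
  cong sum (map-cong (λ k → cong₂ _*_ (f≈f′ k) (g≈g′ (n ∸ k))) (upTo (suc n)))

⋆-distribʳ-⊕ : (f g h : Series) → ((f ⊕ g) ⋆ h) ≈S ((f ⋆ h) ⊕ (g ⋆ h))
⋆-distribʳ-⊕ f g h n =
  trans (cong sum (map-cong (λ k → *-distribʳ-+ (h (n ∸ k)) (f k) (g k)) (upTo (suc n))))
        (sum-map-+ (λ k → f k * h (n ∸ k)) (λ k → g k * h (n ∸ k)) (upTo (suc n)))

⋆-unfoldˡ : (f g : Series) (n : ℕ) → (f ⋆ g) n ≡ f 0 * g n + tx ((f ∘ suc) ⋆ g) n
⋆-unfoldˡ f g zero = refl
⋆-unfoldˡ f g (suc n) = cong (f 0 * g (suc n) +_) (cong sum (begin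
  map (λ k → f k * g (suc n ∸ k)) (applyUpTo suc (suc n))
    ≡⟨ map-applyUpTo suc (λ k → f k * g (suc n ∸ k)) (suc n) ⟩
  applyUpTo (λ k → f (suc k) * g (n ∸ k)) (suc n)
    ≡⟨ map-upTo (λ k → f (suc k) * g (n ∸ k)) (suc n) ⟨
  map (λ k → f (suc k) * g (n ∸ k)) (upTo (suc n)) ∎))
  where open ≡-Reasoning

⋆-tx : (f g : Series) → (f ⋆ tx g) ≈S tx (f ⋆ g)
⋆-tx f g zero = cong (_+ 0) (*-zeroʳ (f 0))
⋆-tx f g (suc n) = begin
  (f ⋆ tx g) (suc n)                     ≡⟨ ⋆-unfoldˡ f (tx g) (suc n) ⟩
  f 0 * g n + ((f ∘ suc) ⋆ tx g) n       ≡⟨ cong (f 0 * g n +_) (⋆-tx (f ∘ suc) g n) ⟩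
  f 0 * g n + tx ((f ∘ suc) ⋆ g) n       ≡⟨ ⋆-unfoldˡ f g n ⟨
  (f ⋆ g) n                              ∎
  where open ≡-Reasoning

⋆-tpow : (k : ℕ) (f g : Series) → (f ⋆ tpow k g) ≈S tpow k (f ⋆ g)
⋆-tpow zero f g n = refl
⋆-tpow (suc k) f g = ≈S-trans (⋆-tx f (tpow k g)) (tx-cong (⋆-tpow k f g))

⋆-tpowʳ : (k : ℕ) (f : Series) {g h : Series} → g ≈S tpow k h → (f ⋆ g) ≈S tpow k (f ⋆ h)
⋆-tpowʳ k f {h = h} g≈tpow = ≈S-trans (⋆-cong {f} (λ _ → refl) g≈tpow) (⋆-tpow k f h)

⋆-oneS : (f : Series) → (f ⋆ oneS) ≈S f
⋆-oneS f zero = trans (+-identityʳ (f 0 * 1)) (*-identityʳ (f 0))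
⋆-oneS f (suc n) =
  trans (⋆-unfoldˡ f oneS (suc n)) (cong₂ _+_ (*-zeroʳ (f 0)) (⋆-oneS (f ∘ suc) n))

colours-suc : (α β : Vec ℕ ℓ) (i : Fin (suc ℓ)) (h : ℕ) →
              colours α β i (suc h) ≡ colours β β i h
colours-suc {ℓ} α β i h with suc (toℕ i) ≤? ℓ
... | no _ = refl
... | yes _ with h
...   | zero  = refl
...   | suc _ = refl

pathCount-[]-suc : (α β α′ β′ : Vec ℕ ℓ) (h m : ℕ) →
                   pathCount α β (suc h) [] (suc m) ≡ pathCount α′ β′ h [] m
pathCount-[]-suc α β α′ β′ h m with suc h ≟ suc m | h ≟ m
... | yes _ | yes _ = refl
... | no _  | no _  = refl
... | yes p | no ¬q = contradiction (suc-injective p) ¬q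
... | no ¬p | yes q = contradiction (cong suc q) ¬p

downWeight : Vec ℕ ℓ → Vec ℕ ℓ → ℕ → Fin (suc ℓ) → ℕ
downWeight α β h i with toℕ i ≤? h
... | yes _ = colours α β i (h ∸ toℕ i)
... | no _  = 0

pathCount-D : (α β : Vec ℕ ℓ) (h : ℕ) (i : Fin (suc ℓ)) (s : List (Step ℓ)) (m : ℕ) →
              pathCount α β h (D i ∷ s) m ≡ downWeight α β h i * pathCount α β (h ∸ toℕ i) s m
pathCount-D α β h i s m with toℕ i ≤? h
... | yes _ = refl
... | no _  = refl

pathsFrom : Vec ℕ ℓ → Vec ℕ ℓ → ℕ → ℕ → Series
pathsFrom {ℓ} α β h m n = sum (map (λ s → pathCount α β h s m) (allSeqs ℓ n))

down : Vec ℕ ℓ → Vec ℕ ℓ → ℕ → (ℕ → Series) → Series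
down {ℓ} α β h F n = sum (map (λ i → downWeight α β h i * F (h ∸ toℕ i) n) (allFin (suc ℓ)))

pathsFrom-suc : (α β : Vec ℕ ℓ) (h m : ℕ) →
  (pathsFrom α β h m ∘ suc) ≈S (pathsFrom α β (suc h) m ⊕ down α β h (λ x → pathsFrom α β x m))
pathsFrom-suc {ℓ} α β h m n = begin
  sum (map P (concatMap (λ s → map (s ∷_) seqs) (allSteps ℓ)))
    ≡⟨ sum-concatMap P (λ s → map (s ∷_) seqs) (allSteps ℓ) ⟩
  sum (map P (map (U ∷_) seqs)) + sum (map (λ s → sum (map P (map (s ∷_) seqs))) (map D fins))
    ≡⟨ cong₂ _+_ (cong sum (map-∘ seqs)) (cong sum (map-∘ fins)) ⟨
  pathsFrom α β (suc h) m n + sum (map (λ i → sum (map P (map (D i ∷_) seqs))) fins)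
    ≡⟨ cong (pathsFrom α β (suc h) m n +_) (cong sum (map-cong stepDown fins)) ⟩
  pathsFrom α β (suc h) m n + down α β h (λ x → pathsFrom α β x m) n ∎
  where
  open ≡-Reasoning
  seqs : List (List (Step ℓ))
  seqs = allSeqs ℓ n
  fins : List (Fin (suc ℓ))
  fins = allFin (suc ℓ)
  P : List (Step ℓ) → ℕ
  P s = pathCount α β h s m
  stepDown : (i : Fin (suc ℓ)) →
    sum (map P (map (D i ∷_) seqs)) ≡ downWeight α β h i * pathsFrom α β (h ∸ toℕ i) m n
  stepDown i = begin
    sum (map P (map (D i ∷_) seqs))
      ≡⟨ cong sum (map-∘ seqs) ⟨
    sum (map (λ s → P (D i ∷ s)) seqs)
      ≡⟨ cong sum (map-cong (λ s → pathCount-D α β h i s m) seqs) ⟩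
    sum (map (λ s → downWeight α β h i * pathCount α β (h ∸ toℕ i) s m) seqs)
      ≡⟨ sum-map-*ˡ (downWeight α β h i) _ seqs ⟩
    downWeight α β h i * pathsFrom α β (h ∸ toℕ i) m n ∎

module _ (α β : Vec ℕ ℓ) (h : ℕ) where

  private
    fins : List (Fin (suc ℓ))
    fins = allFin (suc ℓ)

  down-cong : {F G : ℕ → Series} (n : ℕ) → (∀ x → F x n ≡ G x n) → down α β h F n ≡ down α β h G n
  down-cong n F≡G = cong sum (map-cong (λ i → cong (downWeight α β h i *_) (F≡G _)) fins)

  down-⊕ : (F G : ℕ → Series) → down α β h (λ x → F x ⊕ G x) ≈S (down α β h F ⊕ down α β h G)
  down-⊕ F G n =
    trans (cong sum (map-cong (λ i → *-distribˡ-+ (downWeight α β h i) _ _) fins))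
          (sum-map-+ (λ i → downWeight α β h i * F (h ∸ toℕ i) n)
                     (λ i → downWeight α β h i * G (h ∸ toℕ i) n) fins)

  down-tx : (F : ℕ → Series) → down α β h (λ x → tx (F x)) ≈S tx (down α β h F)
  down-tx F zero =
    trans (cong sum (map-cong (λ i → *-zeroʳ (downWeight α β h i)) fins)) (sum-map-zero fins)
  down-tx F (suc n) = refl

  down-⋆ : (F : ℕ → Series) (g : Series) → (down α β h F ⋆ g) ≈S down α β h (λ x → F x ⋆ g)
  down-⋆ F g n = begin
    sum (map (λ k → down α β h F k * g (n ∸ k)) ks)
      ≡⟨ cong sum (map-cong (λ k → sum-map-*ʳ (g (n ∸ k)) (term k) fins) ks) ⟨
    sum (map (λ k → sum (map (λ i → term k i * g (n ∸ k)) fins)) ks)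
      ≡⟨ sum-map-comm (λ k i → term k i * g (n ∸ k)) ks fins ⟩
    sum (map (λ i → sum (map (λ k → term k i * g (n ∸ k)) ks)) fins)
      ≡⟨ cong sum (map-cong pullWeight fins) ⟩
    down α β h (λ x → F x ⋆ g) n ∎
    where
    open ≡-Reasoning
    ks : List ℕ
    ks = upTo (suc n)
    term : ℕ → Fin (suc ℓ) → ℕ
    term k i = downWeight α β h i * F (h ∸ toℕ i) k
    pullWeight : (i : Fin (suc ℓ)) →
      sum (map (λ k → term k i * g (n ∸ k)) ks) ≡ downWeight α β h i * (F (h ∸ toℕ i) ⋆ g) n
    pullWeight i =
      trans (cong sum (map-cong (λ k → *-assoc (downWeight α β h i) _ _) ks))
            (sum-map-*ˡ (downWeight α β h i) _ ks)

-- The (α,β)-paths from height x to m+1 that never visit height 0: there are none from 0,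
-- and from x+1 they are the (β,β)-paths from x to m, lifted by one.
avoidingZero : Vec ℕ ℓ → ℕ → ℕ → Series
avoidingZero β m zero _ = 0
avoidingZero β m (suc x) = pathsFrom β β x m

down-avoidingZero-zero : (α β : Vec ℕ ℓ) (m n : ℕ) → down α β 0 (avoidingZero β m) n ≡ 0
down-avoidingZero-zero {ℓ} α β m n =
  trans (cong sum (map-cong landsAtZero (allFin (suc ℓ)))) (sum-map-zero (allFin (suc ℓ)))
  where
  landsAtZero : (i : Fin (suc ℓ)) → downWeight α β 0 i * avoidingZero β m (0 ∸ toℕ i) n ≡ 0
  landsAtZero i =
    trans (cong (λ x → downWeight α β 0 i * avoidingZero β m x n) (0∸n≡0 (toℕ i)))
          (*-zeroʳ (downWeight α β 0 i))

down-avoidingZero-suc : (α β : Vec ℕ ℓ) (m h : ℕ) →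
  down α β (suc h) (avoidingZero β m) ≈S down β β h (λ x → pathsFrom β β x m)
down-avoidingZero-suc {ℓ} α β m h n = cong sum (map-cong shiftTerm (allFin (suc ℓ)))
  where
  shiftTerm : (i : Fin (suc ℓ)) →
    downWeight α β (suc h) i * avoidingZero β m (suc h ∸ toℕ i) n ≡
    downWeight β β h i * pathsFrom β β (h ∸ toℕ i) m n
  shiftTerm i with toℕ i ≤? suc h | toℕ i ≤? h
  ... | yes _   | yes i≤h rewrite +-∸-assoc 1 i≤h =
    cong (_* pathsFrom β β (h ∸ toℕ i) m n) (colours-suc α β i (h ∸ toℕ i))
  ... | yes _   | no i≰h rewrite m≤n⇒m∸n≡0 (≰⇒> i≰h) = *-zeroʳ (colours α β i 0)
  ... | no i≰1+h | yes i≤h = contradiction (m≤n⇒m≤1+n i≤h) i≰1+h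
  ... | no _    | no _    = refl

-- The factor pathsFrom α β h 0 0 is 1 for h = 0 and 0 otherwise.
avoidingZero-step : (α β : Vec ℕ ℓ) (m h n : ℕ) →
  avoidingZero β m (suc h) n + down α β h (avoidingZero β m) n ≡
  avoidingZero β m h (suc n) + pathsFrom α β h 0 0 * pathsFrom β β 0 m n
avoidingZero-step α β m zero n = cong (pathsFrom β β 0 m n +_) (down-avoidingZero-zero α β m n)
avoidingZero-step α β m (suc h) n = begin
  pathsFrom β β (suc h) m n + down α β (suc h) (avoidingZero β m) n
    ≡⟨ cong (pathsFrom β β (suc h) m n +_) (down-avoidingZero-suc α β m h n) ⟩
  pathsFrom β β (suc h) m n + down β β h (λ x → pathsFrom β β x m) n
    ≡⟨ pathsFrom-suc β β h m n ⟨
  pathsFrom β β h m (suc n)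
    ≡⟨ +-identityʳ _ ⟨
  pathsFrom β β h m (suc n) + 0 ∎
  where open ≡-Reasoning

pathsFrom-lastZero : (α β : Vec ℕ ℓ) (m n h : ℕ) →
  pathsFrom α β h (suc m) n ≡
  (avoidingZero β m h ⊕ tx (pathsFrom α β h 0 ⋆ pathsFrom β β 0 m)) n
pathsFrom-lastZero α β m zero zero = refl
pathsFrom-lastZero α β m zero (suc h) =
  trans (cong (_+ 0) (pathCount-[]-suc α β β β h m)) (sym (+-identityʳ _))
pathsFrom-lastZero α β m (suc n) h = begin
  pathsFrom α β h (suc m) (suc n)
    ≡⟨ pathsFrom-suc α β h (suc m) n ⟩
  pathsFrom α β (suc h) (suc m) n + down α β h (λ x → pathsFrom α β x (suc m)) n
    ≡⟨ cong₂ _+_ (pathsFrom-lastZero α β m n (suc h)) downIH ⟩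
  (R (suc h) n + T (suc h) n) + (down α β h R n + down α β h T n)
    ≡⟨ interchange (R (suc h) n) (T (suc h) n) _ _ ⟩
  (R (suc h) n + down α β h R n) + (T (suc h) n + down α β h T n)
    ≡⟨ cong₂ _+_ (avoidingZero-step α β m h n) returningStep ⟩
  (R h (suc n) + a h 0 * w n) + tx ((a h ∘ suc) ⋆ w) n
    ≡⟨ +-assoc (R h (suc n)) _ _ ⟩
  R h (suc n) + (a h 0 * w n + tx ((a h ∘ suc) ⋆ w) n)
    ≡⟨ cong (R h (suc n) +_) (⋆-unfoldˡ (a h) w n) ⟨
  R h (suc n) + (a h ⋆ w) n ∎
  where
  open ≡-Reasoning
  R : ℕ → Series
  R = avoidingZero β m
  a : ℕ → Series
  a x = pathsFrom α β x 0
  w : Series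
  w = pathsFrom β β 0 m
  T : ℕ → Series
  T x = tx (a x ⋆ w)

  downIH : down α β h (λ x → pathsFrom α β x (suc m)) n ≡ down α β h R n + down α β h T n
  downIH =
    trans (down-cong α β h {λ x → pathsFrom α β x (suc m)} {λ x → R x ⊕ T x} n
                     (pathsFrom-lastZero α β m n))
          (down-⊕ α β h R T n)

  returningStep : T (suc h) n + down α β h T n ≡ tx ((a h ∘ suc) ⋆ w) n
  returningStep = begin
    T (suc h) n + down α β h T n
      ≡⟨ cong (T (suc h) n +_) (down-tx α β h (λ x → a x ⋆ w) n) ⟩
    T (suc h) n + tx (down α β h (λ x → a x ⋆ w)) n
      ≡⟨ cong (T (suc h) n +_) (tx-cong (down-⋆ α β h a w) n) ⟨
    T (suc h) n + tx (down α β h a ⋆ w) n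
      ≡⟨ tx-⊕ (a (suc h) ⋆ w) (down α β h a ⋆ w) n ⟨
    tx ((a (suc h) ⋆ w) ⊕ (down α β h a ⋆ w)) n
      ≡⟨ tx-cong (⋆-distribʳ-⊕ (a (suc h)) (down α β h a) w) n ⟨
    tx ((a (suc h) ⊕ down α β h a) ⋆ w) n
      ≡⟨ tx-cong (⋆-cong (λ k → sym (pathsFrom-suc α β h 0 k)) (λ _ → refl)) n ⟩
    tx ((a h ∘ suc) ⋆ w) n ∎

Mgf-suc : (α β : Vec ℕ ℓ) (m : ℕ) → Mgf ℓ α β (suc m) ≈S tx (Mgf ℓ α β 0 ⋆ Mgf ℓ β β m)
Mgf-suc α β m n = pathsFrom-lastZero α β m n 0

Mgf-pow : (β : Vec ℕ ℓ) (m : ℕ) → Mgf ℓ β β m ≈S tpow m (Mgf ℓ β β 0 ^S suc m)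
Mgf-pow β zero n = sym (⋆-oneS (Mgf _ β β 0) n)
Mgf-pow β (suc m) = ≈S-trans (Mgf-suc β β m) (tx-cong (⋆-tpowʳ m (Mgf _ β β 0) (Mgf-pow β m)))

proposition2p2 : (ℓ : ℕ) → 1 ≤ ℓ → (α β : Vec ℕ ℓ) → (m : ℕ) → 1 ≤ m →
    (Mgf ℓ α β m ≈S tx (Mgf ℓ α β 0 ⋆ Mgf ℓ β β (m ∸ 1)))
    × (tx (Mgf ℓ α β 0 ⋆ Mgf ℓ β β (m ∸ 1)) ≈S tpow m (Mgf ℓ α β 0 ⋆ (Mgf ℓ β β 0 ^S m)))
proposition2p2 ℓ _ α β (suc m) (s≤s z≤n) =
  Mgf-suc α β m , tx-cong (⋆-tpowʳ m (Mgf ℓ α β 0) (Mgf-pow β m))
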